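{- Let $k\ge 2$ and $n\ge 1$ be integers. Every $k$-uniform linear hypergraph $\mathcal H$ on $n$ vertices that does not contain the $k$-fan $F^k$ as a subhypergraph has at most $n^2/k^2$ edges; that is, $\mathrm{ex}_{\rm lin}(n,F^k)\le n^2/k^2$. Moreover, such an $\mathcal H$ has exactly $n^2/k^2$ edges if and only if $n\equiv 0\pmod k$ and $\mathcal H$ is a transversal design on $n$ vertices with $k$ groups.
   Context: A $k$-uniform hypergraph has a vertex set $V$ and an edge set consisting of distinct $k$-element subsets of $V$. It is linear if any two distinct edges share at most one vertex. $\mathcal H$ contains $\mathcal F$ as a subhypergraph if some subset of the edges of $\mathcal H$ together with their vertices forms a copy isomorphic to $\mathcal F$ (not necessarily induced). For a family $\mathcal F$, $\mathrm{ex}_{\rm lin}(n,\mathcal F)$ is the maximum number of edges of a $k$-uniform linear hypergraph on $n$ vertices containing no member of $\mathcal F$ as a subhypergraph. The $k$-fan $F^k$ ($k\ge2$) is the linear $k$-uniform hypergraph with $k+1$ edges $f_1,\dots,f_k,g$, where $f_1,\dots,f_k$ all contain a common vertex $v$ (and pairwise meet only in $v$), and $g$ does not contain $v$ and meets each $f_i$ in exactly one vertex (different from $v$). A transversal design on $n$ vertices with $k$ groups is a $k$-uniform hypergraph whose vertex set is partitioned into $k$ groups of equal size $n/k$ such that every edge has exactly one vertex in each group and every pair of vertices from different groups is contained in exactly one edge. -}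

module Defs where

open import Data.Nat using (ℕ; _≤_; _*_)
open import Data.Fin using (Fin; _≟_)
open import Data.Fin.Subset using (Subset; _∈_; _∉_; _∩_; ∣_∣)
open import Data.Vec using (tabulate)
open import Data.List using (List; length)
open import Data.List.Relation.Unary.All using (All)
open import Data.List.Relation.Unary.Unique.Propositional using (Unique)
import Data.List.Membership.Propositional as LM
open import Data.Product using (Σ; ∃; _×_; _,_)
open import Relation.Binary.PropositionalEquality using (_≡_; _≢_)
open import Relation.Nullary.Decidable using (⌊_⌋)

Hypergraph : ℕ → Set
Hypergraph n = List (Subset n)

_∈E_ : ∀ {n} → Subset n → Hypergraph n → Set
e ∈E H = e LM.∈ H

IsUniform : ∀ {n} → ℕ → Hypergraph n → Set
IsUniform k H = Unique H × All (λ e → ∣ e ∣ ≡ k) H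

IsLinear : ∀ {n} → Hypergraph n → Set
IsLinear H = ∀ e f → e ∈E H → f ∈E H → e ≢ f → ∣ e ∩ f ∣ ≤ 1

numEdges : ∀ {n} → Hypergraph n → ℕ
numEdges H = length H

-- H contains a copy of the k-fan F^k: a vertex v, edges f₁..f_k and g of H such that
-- f i ∩ f j = {v} for i ≠ j, v ∉ g, and g meets each f i in exactly one vertex
-- (necessarily different from v).
ContainsFan : ∀ {n} → ℕ → Hypergraph n → Set
ContainsFan {n} k H =
  Σ (Fin n) λ v → Σ (Fin k → Subset n) λ f → Σ (Subset n) λ g →
    (∀ i → f i ∈E H) × g ∈E H ×
    (∀ i → v ∈ f i) ×
    (∀ i j → i ≢ j → ∀ x → x ∈ f i → x ∈ f j → x ≡ v) ×
    v ∉ g ×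
    (∀ i → Σ (Fin n) λ u → u ∈ g × u ∈ f i ×
             (∀ x → x ∈ g → x ∈ f i → x ≡ u))

groupSize : ∀ {n k} → (Fin n → Fin k) → Fin k → ℕ
groupSize grp j = ∣ tabulate (λ x → ⌊ grp x ≟ j ⌋) ∣

-- H is a transversal design on n vertices with k groups:
-- a partition of the vertices into k groups (grp assigns each vertex its group),
-- each of size n/k; every edge has exactly one vertex in each group; every pair of
-- vertices from different groups lies in exactly one edge.
IsTransversalDesign : ∀ {n} → ℕ → Hypergraph n → Set
IsTransversalDesign {n} k H =
  Σ (Fin n → Fin k) λ grp →
    (∀ j → groupSize grp j * k ≡ n) ×
    (∀ e → e ∈E H → ∀ j → Σ (Fin n) λ x → x ∈ e × grp x ≡ j ×
                                (∀ y → y ∈ e → grp y ≡ j → y ≡ x)) ×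
    (∀ x y → grp x ≢ grp y →
       Σ (Subset n) λ e → e ∈E H × x ∈ e × y ∈ e ×
         (∀ e′ → e′ ∈E H → x ∈ e′ → y ∈ e′ → e′ ≡ e))

module Submission where

-- Let codeg x y count the edges through x and y
-- (≤ 1 for x ≠ y by linearity) and, for an edge g and v ∉ g, let reach g v = ∑_{x∈g} codeg x v.
-- If reach g v = k, every vertex of g is joined to v and these k edges with g form a fan;
-- so reach g v ≤ k − 1.  Double counting gives
--   (k − 1)·∑_{x∈g} deg x = (k − 1)·k + ∑_{v∉g} reach g v ≤ (k − 1)·n,
-- so ∑ deg² = ∑_g ∑_{x∈g} deg x ≤ m n, and Cauchy–Schwarz, (m k)² = (∑ deg)² ≤ n ∑ deg²,
-- gives m k² ≤ n².  At equality all degrees equal n/k and reach g v = k − 1 whenever v ∉ g;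
-- then "not joined by an edge" is an equivalence whose classes, met once by every edge, form a
-- transversal design.  Conversely in a transversal design every degree is n/k, so m k² = n².

open import Defs
open import Data.Nat
  using (ℕ; zero; suc; _+_; _*_; _≤_; _<_; _<?_; z≤n; s≤s; ∣_-_∣; NonZero; ≢-nonZero; ≢-nonZero⁻¹)
open import Data.Nat.Properties
open import Data.Nat.Divisibility using (_∣_; divides)
open import Data.Nat.Tactic.RingSolver using (solve-∀)
open import Data.Bool using (true; false; if_then_else_)
import Data.Bool.Properties as Bool
open import Data.Fin using (Fin; zero; suc; fromℕ<) renaming (_≟_ to _≟ᶠ_)
open import Data.Fin.Properties using (nonZeroIndex) renaming (suc-injective to fsuc-injective)
open import Data.Fin.Subset using (Subset; _∈_; _∉_; _∩_; ∣_∣)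
open import Data.Vec using ([]; _∷_; lookup; tabulate; here; there)
open import Data.Vec.Properties using ([]=⇒lookup; lookup⇒[]=; ≡-dec; lookup∘tabulate)
open import Data.Product using (Σ; ∃; _×_; _,_; proj₁; proj₂)
open import Data.Sum using (_⊎_; inj₁; inj₂; reduce)
open import Data.Empty using (⊥-elim)
open import Function using (_∘_)
open import Data.List using (List; length)
import Data.List as List
open import Data.List.Relation.Unary.All as All using (All)
open import Data.List.Relation.Unary.AllPairs using (_∷_)
open import Data.List.Relation.Unary.Unique.Propositional using (Unique)
open import Data.List.Relation.Unary.Any using (index)
open import Data.List.Relation.Unary.Any.Properties using (lookup-index)
open import Data.List.Membership.Propositional.Properties using (∈-lookup)
open import Data.Fin.Subset.Properties using (_∈?_)
open import Function.Bundles using (_⇔_; mk⇔)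
open import Relation.Binary.PropositionalEquality
open import Relation.Nullary using (¬_; yes; no)
open import Relation.Nullary.Decidable using (⌊_⌋)
open import Algebra.Properties.Semiring.Sum +-*-semiring
  using (sum; sum-syntax; sum-cong-≗; ∑-distrib-+; ∑-comm; *-distribˡ-sum; *-distribʳ-sum;
         sum-replicate-zero)

sum-const : ∀ n c → ∑[ i < n ] c ≡ n * c
sum-const zero    c = refl
sum-const (suc n) c = cong (c +_) (sum-const n c)

sum-ones : ∀ n → ∑[ i < n ] 1 ≡ n
sum-ones n = trans (sum-const n 1) (*-identityʳ n)

sum-mono : ∀ {n} {f g : Fin n → ℕ} → (∀ i → f i ≤ g i) → sum f ≤ sum g
sum-mono {zero}  _   = z≤n
sum-mono {suc n} f≤g = +-mono-≤ (f≤g zero) (sum-mono (f≤g ∘ suc))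

sum-mono-< : ∀ {n} {f g : Fin n → ℕ} → (∀ i → f i ≤ g i) →
             ∀ a → f a < g a → suc (sum f) ≤ sum g
sum-mono-< f≤g zero    fa<ga = +-mono-≤ fa<ga (sum-mono (f≤g ∘ suc))
sum-mono-< {f = f} {g} f≤g (suc a) fa<ga =
  subst (_≤ sum g) (+-suc (f zero) _) (+-mono-≤ (f≤g zero) (sum-mono-< (f≤g ∘ suc) a fa<ga))

-- Strict inequality at two distinct places gains 2: raise f to g at a first.
sum-mono-<₂ : ∀ {n} {f g : Fin n → ℕ} → (∀ i → f i ≤ g i) →
              ∀ a b → a ≢ b → f a < g a → f b < g b → 2 + sum f ≤ sum g
sum-mono-<₂ {f = f} {g} f≤g a b a≢b fa<ga fb<gb =
  ≤-trans (s≤s (sum-mono-< f≤h a (subst (f a <_) (sym ha) fa<ga)))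
          (sum-mono-< h≤g b (subst (_< g b) (sym hb) fb<gb))
  where
  h : Fin _ → ℕ
  h i with i ≟ᶠ a
  ... | yes _ = g i
  ... | no  _ = f i
  ha : h a ≡ g a
  ha with a ≟ᶠ a
  ... | yes _   = refl
  ... | no  a≢a = ⊥-elim (a≢a refl)
  hb : h b ≡ f b
  hb with b ≟ᶠ a
  ... | yes b≡a = ⊥-elim (a≢b (sym b≡a))
  ... | no  _   = refl
  f≤h : ∀ i → f i ≤ h i
  f≤h i with i ≟ᶠ a
  ... | yes _ = f≤g i
  ... | no  _ = ≤-refl
  h≤g : ∀ i → h i ≤ g i
  h≤g i with i ≟ᶠ a
  ... | yes _ = ≤-refl
  ... | no  _ = f≤g i

sum-mono-≡ : ∀ {n} {f g : Fin n → ℕ} → (∀ i → f i ≤ g i) → sum f ≡ sum g →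
             ∀ i → f i ≡ g i
sum-mono-≡ f≤g Σf≡Σg i with m≤n⇒m<n∨m≡n (f≤g i)
... | inj₁ fi<gi = ⊥-elim (<-irrefl Σf≡Σg (sum-mono-< f≤g i fi<gi))
... | inj₂ fi≡gi = fi≡gi

term≤sum : ∀ {n} (f : Fin n → ℕ) i → f i ≤ sum f
term≤sum f zero    = m≤m+n _ _
term≤sum f (suc i) = ≤-trans (term≤sum (f ∘ suc) i) (m≤n+m _ _)

sum≡0 : ∀ {n} (f : Fin n → ℕ) → sum f ≡ 0 → ∀ i → f i ≡ 0
sum≡0 f Σf≡0 i = n≤0⇒n≡0 (subst (f i ≤_) Σf≡0 (term≤sum f i))

sum-single : ∀ {n} (f : Fin n → ℕ) a → (∀ i → i ≢ a → f i ≡ 0) → sum f ≡ f a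
sum-single {suc n} f zero f≡0 =
  trans (cong (f zero +_) (trans (sum-cong-≗ (λ i → f≡0 (suc i) λ ())) (sum-replicate-zero n)))
        (+-identityʳ _)
sum-single {suc n} f (suc a) f≡0 =
  cong₂ _+_ (f≡0 zero λ ())
            (sum-single (f ∘ suc) a (λ i i≢a → f≡0 (suc i) (i≢a ∘ fsuc-injective)))

sum-<⇒term-< : ∀ {n} (f g : Fin n → ℕ) → sum f < sum g → ∃ λ i → f i < g i
sum-<⇒term-< {suc n} f g Σf<Σg with f zero <? g zero
... | yes f₀<g₀ = zero , f₀<g₀
... | no  f₀≮g₀ with sum-<⇒term-< (f ∘ suc) (g ∘ suc) (+-cancelˡ-< (g zero) _ _ shifted)
  where
  shifted : g zero + sum (f ∘ suc) < g zero + sum (g ∘ suc)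
  shifted = ≤-<-trans (+-monoˡ-≤ _ (≮⇒≥ f₀≮g₀)) Σf<Σg
...   | i , fi<gi = suc i , fi<gi

sum-pos : ∀ {n} (f : Fin n → ℕ) → 0 < sum f → ∃ λ i → 0 < f i
sum-pos {n} f 0<Σf = sum-<⇒term-< (λ _ → 0) f (subst (_< sum f) (sym (sum-replicate-zero n)) 0<Σf)

only : ∀ {n} → Fin n → ℕ → Fin n → ℕ
only a c i with i ≟ᶠ a
... | yes _ = c
... | no  _ = 0

sum-only : ∀ {n} (a : Fin n) c → sum (only a c) ≡ c
sum-only a c = trans (sum-single (only a c) a vanishes) at-a
  where
  vanishes : ∀ i → i ≢ a → only a c i ≡ 0
  vanishes i i≢a with i ≟ᶠ a
  ... | yes i≡a = ⊥-elim (i≢a i≡a)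
  ... | no  _   = refl
  at-a : only a c a ≡ c
  at-a with a ≟ᶠ a
  ... | yes _   = refl
  ... | no  a≢a = ⊥-elim (a≢a refl)

square-gap : ∀ a b → a * a + b * b ≡ 2 * (a * b) + ∣ a - b ∣ * ∣ a - b ∣
square-gap a b with ≤-total a b
... | inj₁ a≤b with m≤n⇒∃[o]m+o≡n a≤b
...   | c , refl rewrite m≤n⇒∣m-n∣≡n∸m a≤b | m+n∸m≡n a c = identity a c
  where
  identity : ∀ a c → a * a + (a + c) * (a + c) ≡ 2 * (a * (a + c)) + c * c
  identity = solve-∀
square-gap a b | inj₂ b≤a with m≤n⇒∃[o]m+o≡n b≤a
...   | c , refl rewrite ∣-∣-comm (b + c) b | m≤n⇒∣m-n∣≡n∸m b≤a | m+n∸m≡n b c =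
  identity b c
  where
  identity : ∀ b c → (b + c) * (b + c) + b * b ≡ 2 * ((b + c) * b) + c * c
  identity = solve-∀

spread : ∀ {n} → (Fin n → ℕ) → ℕ
spread {n} a = ∑[ x < n ] ∑[ y < n ] (∣ a x - a y ∣ * ∣ a x - a y ∣)

lagrange : ∀ {n} (a : Fin n → ℕ) →
           2 * (n * ∑[ x < n ] (a x * a x)) ≡ 2 * (sum a * sum a) + spread a
lagrange {n} a = begin
    2 * (n * Q)
  ≡⟨ double (n * Q) ⟩
    n * Q + n * Q
  ≡⟨ cong₂ _+_ (*-distribˡ-sum n (λ x → a x * a x)) (sym (sum-const n Q)) ⟩
    ∑[ x < n ] (n * (a x * a x)) + ∑[ x < n ] Q
  ≡⟨ cong (_+ ∑[ x < n ] Q) (sum-cong-≗ λ x → sym (sum-const n (a x * a x))) ⟩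
    ∑[ x < n ] ∑[ y < n ] (a x * a x) + ∑[ x < n ] ∑[ y < n ] (a y * a y)
  ≡⟨ sym (∑-distrib-+ (λ x → ∑[ y < n ] (a x * a x)) (λ _ → Q)) ⟩
    ∑[ x < n ] (∑[ y < n ] (a x * a x) + ∑[ y < n ] (a y * a y))
  ≡⟨ sum-cong-≗ (λ x → sym (∑-distrib-+ (λ _ → a x * a x) (λ y → a y * a y))) ⟩
    ∑[ x < n ] ∑[ y < n ] (a x * a x + a y * a y)
  ≡⟨ sum-cong-≗ (λ x → sum-cong-≗ λ y → square-gap (a x) (a y)) ⟩
    ∑[ x < n ] ∑[ y < n ] (2 * (a x * a y) + gap x y)
  ≡⟨ sum-cong-≗ (λ x → ∑-distrib-+ (λ y → 2 * (a x * a y)) (gap x)) ⟩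
    ∑[ x < n ] (∑[ y < n ] (2 * (a x * a y)) + ∑[ y < n ] gap x y)
  ≡⟨ ∑-distrib-+ (λ x → ∑[ y < n ] (2 * (a x * a y))) (λ x → ∑[ y < n ] gap x y) ⟩
    ∑[ x < n ] ∑[ y < n ] (2 * (a x * a y)) + spread a
  ≡⟨ cong (_+ spread a) (sum-cong-≗ λ x →
       trans (sum-cong-≗ λ y → sym (*-assoc 2 (a x) (a y)))
             (trans (sym (*-distribˡ-sum (2 * a x) a)) (*-assoc 2 (a x) (sum a)))) ⟩
    ∑[ x < n ] (2 * (a x * sum a)) + spread a
  ≡⟨ cong (_+ spread a) (trans (sym (*-distribˡ-sum 2 (λ x → a x * sum a)))
                               (cong (2 *_) (sym (*-distribʳ-sum (sum a) a)))) ⟩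
    2 * (sum a * sum a) + spread a
  ∎
  where
  open ≡-Reasoning
  Q = ∑[ x < n ] (a x * a x)
  gap : Fin n → Fin n → ℕ
  gap x y = ∣ a x - a y ∣ * ∣ a x - a y ∣
  double : ∀ t → 2 * t ≡ t + t
  double = solve-∀

cauchy-schwarz : ∀ {n} (a : Fin n → ℕ) → sum a * sum a ≤ n * ∑[ x < n ] (a x * a x)
cauchy-schwarz a =
  *-cancelˡ-≤ 2 (subst (2 * (sum a * sum a) ≤_) (sym (lagrange a)) (m≤m+n _ (spread a)))

cauchy-schwarz-≡ : ∀ {n} (a : Fin n → ℕ) → n * ∑[ x < n ] (a x * a x) ≡ sum a * sum a →
                   ∀ x y → a x ≡ a y
cauchy-schwarz-≡ a tight x y =
  ∣m-n∣≡0⇒m≡n (reduce (m*n≡0⇒m≡0∨n≡0 ∣ a x - a y ∣ (sum≡0 _ (sum≡0 _ spread≡0 x) y)))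
  where
  spread≡0 : spread a ≡ 0
  spread≡0 = +-cancelˡ-≡ (2 * (sum a * sum a)) (spread a) 0
    (trans (sym (lagrange a)) (trans (cong (2 *_) tight) (sym (+-identityʳ _))))

χ : ∀ {n} → Subset n → Fin n → ℕ
χ s x = if lookup s x then 1 else 0

χᶜ : ∀ {n} → Subset n → Fin n → ℕ
χᶜ s x = if lookup s x then 0 else 1

χ≤1 : ∀ {n} (s : Subset n) x → χ s x ≤ 1
χ≤1 s x with lookup s x
... | true  = ≤-refl
... | false = z≤n

χ+χᶜ : ∀ {n} (s : Subset n) x → χ s x + χᶜ s x ≡ 1
χ+χᶜ s x with lookup s x
... | true  = refl
... | false = refl

χ*χᶜ : ∀ {n} (s : Subset n) x → χ s x * χᶜ s x ≡ 0
χ*χᶜ s x with lookup s x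
... | true  = refl
... | false = refl

χ*χ : ∀ {n} (s : Subset n) x → χ s x * χ s x ≡ χ s x
χ*χ s x with lookup s x
... | true  = refl
... | false = refl

χ-∩ : ∀ {n} (s t : Subset n) x → χ (s ∩ t) x ≡ χ s x * χ t x
χ-∩ (true  ∷ s) (true  ∷ t) zero    = refl
χ-∩ (true  ∷ s) (false ∷ t) zero    = refl
χ-∩ (false ∷ s) (_     ∷ t) zero    = refl
χ-∩ (_     ∷ s) (_     ∷ t) (suc x) = χ-∩ s t x

∈⇒χ≡1 : ∀ {n} {s : Subset n} {x} → x ∈ s → χ s x ≡ 1
∈⇒χ≡1 x∈s rewrite []=⇒lookup x∈s = refl

∉⇒χ≡0 : ∀ {n} {s : Subset n} {x} → x ∉ s → χ s x ≡ 0
∉⇒χ≡0 {s = s} {x} x∉s with lookup s x in eq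
... | true  = ⊥-elim (x∉s (lookup⇒[]= x s eq))
... | false = refl

∈⇒χᶜ≡0 : ∀ {n} {s : Subset n} {x} → x ∈ s → χᶜ s x ≡ 0
∈⇒χᶜ≡0 x∈s rewrite []=⇒lookup x∈s = refl

∉⇒χᶜ≡1 : ∀ {n} {s : Subset n} {x} → x ∉ s → χᶜ s x ≡ 1
∉⇒χᶜ≡1 {s = s} {x} x∉s with lookup s x in eq
... | true  = ⊥-elim (x∉s (lookup⇒[]= x s eq))
... | false = refl

χ*χ-pos⇒∈ : ∀ {n} {s t : Subset n} {x y} → 0 < χ s x * χ t y → x ∈ s × y ∈ t
χ*χ-pos⇒∈ {s = s} {t} {x} {y} 0<χχ with lookup s x in eq | lookup t y in eq′
... | true | true = lookup⇒[]= x s eq , lookup⇒[]= y t eq′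

∣∣≡∑χ : ∀ {n} (s : Subset n) → ∣ s ∣ ≡ sum (χ s)
∣∣≡∑χ []          = refl
∣∣≡∑χ (true  ∷ s) = cong suc (∣∣≡∑χ s)
∣∣≡∑χ (false ∷ s) = ∣∣≡∑χ s

Enumeration : ∀ {n} → Subset n → ℕ → Set
Enumeration {n} s c =
  Σ (Fin c → Fin n) λ xs → (∀ j → xs j ∈ s) × (∀ i j → xs i ≡ xs j → i ≡ j) ×
                           (∀ x → x ∈ s → ∃ λ j → xs j ≡ x)

enumerate : ∀ {n} (s : Subset n) → Enumeration s ∣ s ∣
enumerate [] = (λ ()) , (λ ()) , (λ ()) , (λ _ ())
enumerate (false ∷ s) with enumerate s
... | xs , mem , inj , onto = suc ∘ xs , there ∘ mem , (λ i j → inj i j ∘ fsuc-injective) , onto′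
  where
  onto′ : ∀ x → x ∈ false ∷ s → ∃ λ j → suc (xs j) ≡ x
  onto′ (suc x) (there x∈s) with onto x x∈s
  ... | j , refl = j , refl
enumerate (true ∷ s) with enumerate s
... | xs , mem , inj , onto = xs′ , mem′ , inj′ , onto′
  where
  xs′ : Fin (suc ∣ s ∣) → Fin _
  xs′ zero    = zero
  xs′ (suc j) = suc (xs j)
  mem′ : ∀ j → xs′ j ∈ true ∷ s
  mem′ zero    = here
  mem′ (suc j) = there (mem j)
  inj′ : ∀ i j → xs′ i ≡ xs′ j → i ≡ j
  inj′ zero    zero    _  = refl
  inj′ (suc i) (suc j) eq = cong suc (inj i j (fsuc-injective eq))
  onto′ : ∀ x → x ∈ true ∷ s → ∃ λ j → xs′ j ≡ x
  onto′ zero    _           = zero , refl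
  onto′ (suc x) (there x∈s) with onto x x∈s
  ... | j , refl = suc j , refl

member : ∀ {n k} → (Fin n → Fin k) → Fin k → Fin n → ℕ
member grp j x = if ⌊ grp x ≟ᶠ j ⌋ then 1 else 0

groupSize≡∑member : ∀ {n k} (grp : Fin n → Fin k) j → groupSize grp j ≡ sum (member grp j)
groupSize≡∑member grp j =
  trans (∣∣≡∑χ (tabulate in-j))
        (sum-cong-≗ λ x → cong (if_then 1 else 0) (lookup∘tabulate in-j x))
  where
  in-j = λ y → ⌊ grp y ≟ᶠ j ⌋

lookup-injective : ∀ {A : Set} {xs : List A} → Unique xs →
                   ∀ i j → List.lookup xs i ≡ List.lookup xs j → i ≡ j
lookup-injective (_ ∷ _) zero zero _ = refl
lookup-injective (x≢xs ∷ _) zero (suc j) eq = ⊥-elim (All.lookup x≢xs (∈-lookup j) eq)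
lookup-injective (x≢xs ∷ _) (suc i) zero eq = ⊥-elim (All.lookup x≢xs (∈-lookup i) (sym eq))
lookup-injective (_ ∷ u) (suc i) (suc j) eq = cong suc (lookup-injective u i j eq)

module Counting {n k′ : ℕ} (H : Hypergraph n) (distinct : Unique H)
                (uniform : All (λ e → ∣ e ∣ ≡ suc k′) H) (linear : IsLinear H) where

  k m : ℕ
  k = suc k′
  m = length H

  E : Fin m → Subset n
  E = List.lookup H

  E∈H : ∀ i → E i ∈E H
  E∈H = ∈-lookup

  edge-index : ∀ {e} → e ∈E H → ∃ λ i → E i ≡ e
  edge-index e∈H = index e∈H , sym (lookup-index e∈H)

  E-injective : ∀ i j → E i ≡ E j → i ≡ j
  E-injective = lookup-injective distinct

  I : Fin m → Fin n → ℕ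
  I i = χ (E i)

  ∣E∣≡k : ∀ i → ∣ E i ∣ ≡ k
  ∣E∣≡k i = All.lookup uniform (E∈H i)

  ∑I≡k : ∀ i → sum (I i) ≡ k
  ∑I≡k i = trans (sym (∣∣≡∑χ (E i))) (∣E∣≡k i)

  edge-enumeration : ∀ g → Enumeration (E g) k
  edge-enumeration g = subst (Enumeration (E g)) (∣E∣≡k g) (enumerate (E g))

  coincide : ∀ {e f a b} → e ∈E H → f ∈E H → a ≢ b →
             a ∈ e → b ∈ e → a ∈ f → b ∈ f → e ≡ f
  coincide {e} {f} {a} {b} e∈H f∈H a≢b a∈e b∈e a∈f b∈f with ≡-dec Bool._≟_ e f
  ... | yes e≡f = e≡f
  ... | no  e≢f = ⊥-elim (<⇒≱ 1<∣e∩f∣ (linear e f e∈H f∈H e≢f))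
    where
    common : ∀ {x} → x ∈ e → x ∈ f → 0 < χ (e ∩ f) x
    common {x} x∈e x∈f rewrite χ-∩ e f x | ∈⇒χ≡1 x∈e | ∈⇒χ≡1 x∈f = s≤s z≤n
    1<∣e∩f∣ : 1 < ∣ e ∩ f ∣
    1<∣e∩f∣ = subst (1 <_) (sym (∣∣≡∑χ (e ∩ f)))
      (subst (λ z → 2 + z ≤ sum (χ (e ∩ f))) (sum-replicate-zero n)
        (sum-mono-<₂ (λ _ → z≤n) a b a≢b (common a∈e a∈f) (common b∈e b∈f)))

  deg : Fin n → ℕ
  deg x = ∑[ i < m ] I i x

  codeg : Fin n → Fin n → ℕ
  codeg x y = ∑[ i < m ] (I i x * I i y)

  codeg-sym : ∀ x y → codeg x y ≡ codeg y x
  codeg-sym x y = sum-cong-≗ λ i → *-comm (I i x) (I i y)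

  codeg-self : ∀ x → codeg x x ≡ deg x
  codeg-self x = sum-cong-≗ λ i → χ*χ (E i) x

  codeg-pos⇒edge : ∀ {x y} → 0 < codeg x y → ∃ λ i → x ∈ E i × y ∈ E i
  codeg-pos⇒edge 0<codeg with sum-pos _ 0<codeg
  ... | i , 0<IxIy = i , χ*χ-pos⇒∈ 0<IxIy

  edge⇒codeg-pos : ∀ i {x y} → x ∈ E i → y ∈ E i → 0 < codeg x y
  edge⇒codeg-pos i {x} {y} x∈i y∈i =
    ≤-trans (≤-reflexive (sym IxIy≡1)) (term≤sum (λ j → I j x * I j y) i)
    where
    IxIy≡1 : I i x * I i y ≡ 1
    IxIy≡1 rewrite ∈⇒χ≡1 x∈i | ∈⇒χ≡1 y∈i = refl

  codeg≤1 : ∀ {x y} → x ≢ y → codeg x y ≤ 1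
  codeg≤1 {x} {y} x≢y with codeg x y ≟ 0
  ... | yes c≡0 = subst (_≤ 1) (sym c≡0) z≤n
  ... | no  c≢0 with codeg-pos⇒edge (n≢0⇒n>0 c≢0)
  ...   | i , x∈i , y∈i =
    subst (_≤ 1) (sym (sum-single _ i others≡0)) (*-mono-≤ (χ≤1 (E i) x) (χ≤1 (E i) y))
    where
    others≡0 : ∀ j → j ≢ i → I j x * I j y ≡ 0
    others≡0 j j≢i with x ∈? E j | y ∈? E j
    ... | yes x∈j | yes y∈j =
      ⊥-elim (j≢i (E-injective j i (coincide (E∈H j) (E∈H i) x≢y x∈j y∈j x∈i y∈i)))
    ... | no  x∉j | _       rewrite ∉⇒χ≡0 x∉j = refl
    ... | yes _   | no  y∉j rewrite ∉⇒χ≡0 y∉j = *-zeroʳ (I j x)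

  O : Fin m → Fin n → ℕ
  O i = χᶜ (E i)

  n≡k+∑O : ∀ g → n ≡ k + sum (O g)
  n≡k+∑O g = begin
      n                                ≡⟨ sum-ones n ⟨
      ∑[ v < n ] 1                     ≡⟨ sum-cong-≗ (λ v → sym (χ+χᶜ (E g) v)) ⟩
      ∑[ v < n ] (I g v + O g v)       ≡⟨ ∑-distrib-+ (I g) (O g) ⟩
      sum (I g) + sum (O g)            ≡⟨ cong (_+ sum (O g)) (∑I≡k g) ⟩
      k + sum (O g)                    ∎
    where open ≡-Reasoning

  meet outside : Fin m → Fin m → ℕ
  meet g e = ∑[ x < n ] (I e x * I g x)
  outside g e = ∑[ x < n ] (I e x * O g x)

  meet+outside : ∀ g e → meet g e + outside g e ≡ k
  meet+outside g e = begin
      meet g e + outside g e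
    ≡⟨ ∑-distrib-+ (λ x → I e x * I g x) (λ x → I e x * O g x) ⟨
      ∑[ x < n ] (I e x * I g x + I e x * O g x)
    ≡⟨ sum-cong-≗ (λ x → *-distribˡ-+ (I e x) (I g x) (O g x)) ⟨
      ∑[ x < n ] (I e x * (I g x + O g x))
    ≡⟨ sum-cong-≗ (λ x → trans (cong (I e x *_) (χ+χᶜ (E g) x)) (*-identityʳ (I e x))) ⟩
      sum (I e)
    ≡⟨ ∑I≡k e ⟩
      k
    ∎
    where open ≡-Reasoning

  meet-self : ∀ g → meet g g ≡ k
  meet-self g = trans (sum-cong-≗ (χ*χ (E g))) (∑I≡k g)

  outside-self : ∀ g → outside g g ≡ 0
  outside-self g = trans (sum-cong-≗ (χ*χᶜ (E g))) (sum-replicate-zero n)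

  meet≤1 : ∀ g e → e ≢ g → meet g e ≤ 1
  meet≤1 g e e≢g = subst (_≤ 1) (trans (∣∣≡∑χ (E e ∩ E g)) (sum-cong-≗ (χ-∩ (E e) (E g))))
                         (linear (E e) (E g) (E∈H e) (E∈H g) (e≢g ∘ E-injective e g))

  per-edge : ∀ g e → k′ * meet g e ≡ only g (k′ * k) e + outside g e * meet g e
  per-edge g e with e ≟ᶠ g
  ... | yes refl rewrite meet-self g | outside-self g = sym (+-identityʳ _)
  ... | no  e≢g with meet g e | meet≤1 g e e≢g | meet+outside g e
  ...   | zero        | _       | _ = trans (*-zeroʳ k′) (sym (*-zeroʳ (outside g e)))
  ...   | suc zero    | _       | 1+out≡k =
    trans (*-identityʳ k′) (trans (suc-injective (sym 1+out≡k)) (sym (*-identityʳ _)))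
  ...   | suc (suc _) | s≤s ()  | _

  degSum : Fin m → ℕ
  degSum g = ∑[ x < n ] (I g x * deg x)

  reach : Fin m → Fin n → ℕ
  reach g v = ∑[ x < n ] (I g x * codeg x v)

  degSum≡∑meet : ∀ g → degSum g ≡ sum (meet g)
  degSum≡∑meet g = begin
      ∑[ x < n ] (I g x * deg x)
    ≡⟨ sum-cong-≗ (λ x → *-distribˡ-sum (I g x) (λ e → I e x)) ⟩
      ∑[ x < n ] ∑[ e < m ] (I g x * I e x)
    ≡⟨ ∑-comm (λ x e → I g x * I e x) ⟩
      ∑[ e < m ] ∑[ x < n ] (I g x * I e x)
    ≡⟨ sum-cong-≗ (λ e → sum-cong-≗ λ x → *-comm (I g x) (I e x)) ⟩
      sum (meet g)
    ∎
    where open ≡-Reasoning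

  -- Counting triples (e, v, x) with v ∈ e ∖ g and x ∈ e ∩ g.
  ∑outside*meet : ∀ g → ∑[ e < m ] (outside g e * meet g e) ≡ ∑[ v < n ] (O g v * reach g v)
  ∑outside*meet g = begin
      ∑[ e < m ] (outside g e * meet g e)
    ≡⟨ sum-cong-≗ (λ e → trans (*-distribʳ-sum (meet g e) (λ v → I e v * O g v))
                                (sum-cong-≗ λ v → *-distribˡ-sum (I e v * O g v) (I-meet e))) ⟩
      ∑[ e < m ] ∑[ v < n ] ∑[ x < n ] term e v x
    ≡⟨ ∑-comm (λ e v → ∑[ x < n ] term e v x) ⟩
      ∑[ v < n ] ∑[ e < m ] ∑[ x < n ] term e v x
    ≡⟨ sum-cong-≗ (λ v → ∑-comm (λ e x → term e v x)) ⟩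
      ∑[ v < n ] ∑[ x < n ] ∑[ e < m ] term e v x
    ≡⟨ sum-cong-≗ (λ v → sum-cong-≗ λ x →
         trans (sum-cong-≗ λ e → rearrange (I e v) (O g v) (I e x) (I g x))
               (sym (*-distribˡ-sum (O g v * I g x) (λ e → I e x * I e v)))) ⟩
      ∑[ v < n ] ∑[ x < n ] (O g v * I g x * codeg x v)
    ≡⟨ sum-cong-≗ (λ v → trans (sum-cong-≗ λ x → *-assoc (O g v) (I g x) (codeg x v))
                                (sym (*-distribˡ-sum (O g v) (λ x → I g x * codeg x v)))) ⟩
      ∑[ v < n ] (O g v * reach g v)
    ∎
    where
    open ≡-Reasoning
    I-meet : Fin m → Fin n → ℕ
    I-meet e x = I e x * I g x
    term : Fin m → Fin n → Fin n → ℕ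
    term e v x = I e v * O g v * I-meet e x
    rearrange : ∀ a b c d → a * b * (c * d) ≡ b * d * (c * a)
    rearrange = solve-∀

  degSum-identity : ∀ g → k′ * degSum g ≡ k′ * k + ∑[ v < n ] (O g v * reach g v)
  degSum-identity g = begin
      k′ * degSum g
    ≡⟨ cong (k′ *_) (degSum≡∑meet g) ⟩
      k′ * sum (meet g)
    ≡⟨ *-distribˡ-sum k′ (meet g) ⟩
      ∑[ e < m ] (k′ * meet g e)
    ≡⟨ sum-cong-≗ (per-edge g) ⟩
      ∑[ e < m ] (only g (k′ * k) e + outside g e * meet g e)
    ≡⟨ ∑-distrib-+ (only g (k′ * k)) (λ e → outside g e * meet g e) ⟩
      sum (only g (k′ * k)) + ∑[ e < m ] (outside g e * meet g e)
    ≡⟨ cong₂ _+_ (sum-only g (k′ * k)) (∑outside*meet g) ⟩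
      k′ * k + ∑[ v < n ] (O g v * reach g v)
    ∎
    where open ≡-Reasoning

  single-meet : ∀ g i {v x y} → v ∉ E g → v ∈ E i →
                x ∈ E g → x ∈ E i → y ∈ E g → y ∈ E i → x ≡ y
  single-meet g i {v} {x} {y} v∉g v∈i x∈g x∈i y∈g y∈i with x ≟ᶠ y
  ... | yes x≡y = x≡y
  ... | no  x≢y =
    ⊥-elim (v∉g (subst (v ∈_) (coincide (E∈H i) (E∈H g) x≢y x∈i y∈i x∈g y∈g) v∈i))

  fan : ∀ g v → v ∉ E g → (∀ x → x ∈ E g → ∃ λ i → x ∈ E i × v ∈ E i) →
        ContainsFan k H
  fan g v v∉g sees with edge-enumeration g
  ... | u , u∈g , u-injective , _ =
    v , f , E g , (λ j → E∈H (spoke j)) , E∈H g , v∈f , centre , v∉g ,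
    λ j → u j , u∈g j , u∈f j , only-u j
    where
    spoke : Fin k → Fin m
    spoke j = proj₁ (sees (u j) (u∈g j))
    f : Fin k → Subset n
    f j = E (spoke j)
    u∈f : ∀ j → u j ∈ f j
    u∈f j = proj₁ (proj₂ (sees (u j) (u∈g j)))
    v∈f : ∀ j → v ∈ f j
    v∈f j = proj₂ (proj₂ (sees (u j) (u∈g j)))
    only-u : ∀ j x → x ∈ E g → x ∈ f j → x ≡ u j
    only-u j x x∈g x∈f = single-meet g (spoke j) v∉g (v∈f j) x∈g x∈f (u∈g j) (u∈f j)
    centre : ∀ i j → i ≢ j → ∀ x → x ∈ f i → x ∈ f j → x ≡ v
    centre i j i≢j x x∈fi x∈fj with x ≟ᶠ v
    ... | yes x≡v = x≡v
    ... | no  x≢v = ⊥-elim (i≢j (u-injective i j (sym (only-u i (u j) (u∈g j) uj∈fi))))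
      where
      fi≡fj : f i ≡ f j
      fi≡fj = coincide (E∈H (spoke i)) (E∈H (spoke j)) x≢v x∈fi (v∈f i) x∈fj (v∈f j)
      uj∈fi : u j ∈ f i
      uj∈fi = subst (u j ∈_) (sym fi≡fj) (u∈f j)

  reach-term≤ : ∀ g v → v ∉ E g → ∀ x → I g x * codeg x v ≤ I g x
  reach-term≤ g v v∉g x with x ∈? E g
  ... | no  x∉g rewrite ∉⇒χ≡0 x∉g = z≤n
  ... | yes x∈g rewrite ∈⇒χ≡1 x∈g = subst (_≤ 1) (sym (+-identityʳ _)) (codeg≤1 x≢v)
    where
    x≢v : x ≢ v
    x≢v refl = v∉g x∈g

  reach≡k⇒fan : ∀ g v → v ∉ E g → reach g v ≡ k → ContainsFan k H
  reach≡k⇒fan g v v∉g reach≡k = fan g v v∉g sees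
    where
    tight : ∀ x → I g x * codeg x v ≡ I g x
    tight = sum-mono-≡ (reach-term≤ g v v∉g) (trans reach≡k (sym (∑I≡k g)))
    sees : ∀ x → x ∈ E g → ∃ λ i → x ∈ E i × v ∈ E i
    sees x x∈g = codeg-pos⇒edge (subst (0 <_) codeg≡1 (s≤s z≤n))
      where
      codeg≡1 : 1 ≡ codeg x v
      codeg≡1 = begin
        1                    ≡⟨ sym (∈⇒χ≡1 x∈g) ⟩
        I g x                ≡⟨ sym (tight x) ⟩
        I g x * codeg x v    ≡⟨ cong (_* codeg x v) (∈⇒χ≡1 x∈g) ⟩
        1 * codeg x v        ≡⟨ *-identityˡ _ ⟩
        codeg x v            ∎
        where open ≡-Reasoning

  -- What degSum-identity would read if every vertex outside g had reach exactly k − 1.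
  k′*n-identity : ∀ g → k′ * n ≡ k′ * k + ∑[ v < n ] (O g v * k′)
  k′*n-identity g = begin
      k′ * n                                 ≡⟨ cong (k′ *_) (n≡k+∑O g) ⟩
      k′ * (k + sum (O g))                   ≡⟨ *-distribˡ-+ k′ k (sum (O g)) ⟩
      k′ * k + k′ * sum (O g)                ≡⟨ cong (k′ * k +_) (*-comm k′ (sum (O g))) ⟩
      k′ * k + sum (O g) * k′                ≡⟨ cong (k′ * k +_) (*-distribʳ-sum k′ (O g)) ⟩
      k′ * k + ∑[ v < n ] (O g v * k′)       ∎
    where open ≡-Reasoning

  ∑deg≡mk : sum deg ≡ m * k
  ∑deg≡mk = trans (∑-comm (λ x i → I i x)) (trans (sum-cong-≗ ∑I≡k) (sum-const m k))

  ∑deg²≡∑degSum : ∑[ x < n ] (deg x * deg x) ≡ sum degSum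
  ∑deg²≡∑degSum = begin
      ∑[ x < n ] (deg x * deg x)
    ≡⟨ sum-cong-≗ (λ x → *-distribˡ-sum (deg x) (λ i → I i x)) ⟩
      ∑[ x < n ] ∑[ i < m ] (deg x * I i x)
    ≡⟨ ∑-comm (λ x i → deg x * I i x) ⟩
      ∑[ i < m ] ∑[ x < n ] (deg x * I i x)
    ≡⟨ sum-cong-≗ (λ i → sum-cong-≗ λ x → *-comm (deg x) (I i x)) ⟩
      sum degSum
    ∎
    where open ≡-Reasoning

  ∑deg²-as-edges : sum deg * sum deg ≡ m * (m * k * k)
  ∑deg²-as-edges = trans (cong₂ _*_ ∑deg≡mk ∑deg≡mk) (regroup m k)
    where
    regroup : ∀ a b → a * b * (a * b) ≡ a * (a * b * b)
    regroup = solve-∀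

  ∑codeg : ∀ w → sum (codeg w) ≡ deg w * k
  ∑codeg w = begin
      ∑[ y < n ] ∑[ i < m ] (I i w * I i y)
    ≡⟨ ∑-comm (λ y i → I i w * I i y) ⟩
      ∑[ i < m ] ∑[ y < n ] (I i w * I i y)
    ≡⟨ sum-cong-≗ (λ i → trans (sym (*-distribˡ-sum (I i w) (I i))) (cong (I i w *_) (∑I≡k i))) ⟩
      ∑[ i < m ] (I i w * k)
    ≡⟨ *-distribʳ-sum k (λ i → I i w) ⟨
      deg w * k
    ∎
    where open ≡-Reasoning

  -- The groups are the classes of
  -- the relation "not joined by an edge", represented by the vertices of a fixed edge g₀.
  module Design (reach≡k′ : ∀ g v → v ∉ E g → reach g v ≡ k′)
                (D : ℕ) (deg≡D : ∀ x → deg x ≡ D) (D*k≡n : D * k ≡ n) (g₀ : Fin m) where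

    non-neighbour : ∀ g v → v ∉ E g → ∃ λ x → x ∈ E g × codeg x v ≡ 0
    non-neighbour g v v∉g with sum-<⇒term-< (λ x → I g x * codeg x v) (I g) reach<∑I
      where
      reach<∑I : reach g v < sum (I g)
      reach<∑I = subst₂ _<_ (sym (reach≡k′ g v v∉g)) (sym (∑I≡k g)) ≤-refl
    ... | x , lt with x ∈? E g
    ...   | no  x∉g =
      ⊥-elim (<-irrefl refl (subst₂ _<_ (cong (_* codeg x v) (∉⇒χ≡0 x∉g)) (∉⇒χ≡0 x∉g) lt))
    ...   | yes x∈g = x , x∈g , n<1⇒n≡0 (subst₂ _<_ codeg-term (∈⇒χ≡1 x∈g) lt)
      where
      codeg-term : I g x * codeg x v ≡ codeg x v
      codeg-term = trans (cong (_* codeg x v) (∈⇒χ≡1 x∈g)) (*-identityˡ _)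

    non-neighbour-unique : ∀ g v → v ∉ E g → ∀ {x y} → x ∈ E g → y ∈ E g →
                           codeg x v ≡ 0 → codeg y v ≡ 0 → x ≡ y
    non-neighbour-unique g v v∉g {x} {y} x∈g y∈g x≁v y≁v with x ≟ᶠ y
    ... | yes x≡y = x≡y
    ... | no  x≢y = ⊥-elim (1+n≰n (subst₂ _≤_ (cong (2 +_) (reach≡k′ g v v∉g)) (∑I≡k g)
                      (sum-mono-<₂ (reach-term≤ g v v∉g) x y x≢y (drop x∈g x≁v) (drop y∈g y≁v))))
      where
      drop : ∀ {z} → z ∈ E g → codeg z v ≡ 0 → I g z * codeg z v < I g z
      drop z∈g z≁v rewrite ∈⇒χ≡1 z∈g | z≁v = s≤s z≤n

    _∥_ : Fin n → Fin n → Set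
    x ∥ y = x ≡ y ⊎ codeg x y ≡ 0

    ∥-sym : ∀ {x y} → x ∥ y → y ∥ x
    ∥-sym (inj₁ refl)        = inj₁ refl
    ∥-sym {x} {y} (inj₂ x≁y) = inj₂ (trans (codeg-sym y x) x≁y)

    joined⇒∦ : ∀ i {x y} → x ∈ E i → y ∈ E i → x ≢ y → ¬ (x ∥ y)
    joined⇒∦ i x∈i y∈i x≢y (inj₁ x≡y) = x≢y x≡y
    joined⇒∦ i x∈i y∈i x≢y (inj₂ x≁y) = <⇒≢ (edge⇒codeg-pos i x∈i y∈i) (sym x≁y)

    -- Transitivity: were x and z joined by an edge, then y, outside it, would have two
    -- non-neighbours x and z on it.
    ∥-trans : ∀ {x y z} → x ∥ y → y ∥ z → x ∥ z
    ∥-trans (inj₁ refl) y∥z = y∥z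
    ∥-trans x∥y (inj₁ refl) = x∥y
    ∥-trans {x} {y} {z} (inj₂ x≁y) (inj₂ y≁z) with codeg x z ≟ 0
    ... | yes x≁z = inj₂ x≁z
    ... | no  x~z with codeg-pos⇒edge (n≢0⇒n>0 x~z)
    ...   | i , x∈i , z∈i =
      inj₁ (non-neighbour-unique i y y∉i x∈i z∈i x≁y (trans (codeg-sym z y) y≁z))
      where
      y∉i : y ∉ E i
      y∉i y∈i = <⇒≢ (edge⇒codeg-pos i x∈i y∈i) (sym x≁y)

    u : Fin k → Fin n
    u = proj₁ (edge-enumeration g₀)

    u∈g₀ : ∀ j → u j ∈ E g₀
    u∈g₀ = proj₁ (proj₂ (edge-enumeration g₀))

    u-injective : ∀ i j → u i ≡ u j → i ≡ j
    u-injective = proj₁ (proj₂ (proj₂ (edge-enumeration g₀)))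

    u-onto : ∀ x → x ∈ E g₀ → ∃ λ j → u j ≡ x
    u-onto = proj₂ (proj₂ (proj₂ (edge-enumeration g₀)))

    -- Every vertex is parallel to a vertex of g₀: itself, or its non-neighbour there.
    representative : ∀ v → ∃ λ j → u j ∥ v
    representative v with v ∈? E g₀
    ... | yes v∈g₀ = proj₁ (u-onto v v∈g₀) , inj₁ (proj₂ (u-onto v v∈g₀))
    ... | no  v∉g₀ with non-neighbour g₀ v v∉g₀
    ...   | x , x∈g₀ , x≁v with u-onto x x∈g₀
    ...     | j , refl = j , inj₂ x≁v

    -- The group of v is the index of its representative, which is unique:
    -- distinct vertices of g₀ are joined by g₀.
    grp : Fin n → Fin k
    grp v = proj₁ (representative v)

    grp-∥ : ∀ v → u (grp v) ∥ v
    grp-∥ v = proj₂ (representative v)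

    grp-unique : ∀ j v → u j ∥ v → j ≡ grp v
    grp-unique j v uj∥v with j ≟ᶠ grp v
    ... | yes j≡ = j≡
    ... | no  j≢ = ⊥-elim (joined⇒∦ g₀ (u∈g₀ j) (u∈g₀ (grp v)) (j≢ ∘ u-injective j (grp v))
                                     (∥-trans uj∥v (∥-sym (grp-∥ v))))

    grp-u : ∀ j → grp (u j) ≡ j
    grp-u j = sym (grp-unique j (u j) (inj₁ refl))

    ∥⇒grp≡ : ∀ {x y} → x ∥ y → grp x ≡ grp y
    ∥⇒grp≡ {x} {y} x∥y = grp-unique (grp x) y (∥-trans (grp-∥ x) x∥y)

    grp≡⇒∥ : ∀ {x y} → grp x ≡ grp y → x ∥ y
    grp≡⇒∥ {x} {y} gx≡gy =
      ∥-trans (∥-sym (grp-∥ x)) (subst (λ j → u j ∥ y) (sym gx≡gy) (grp-∥ y))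

    -- Each vertex x is in group j or joined to u j (once), and u j itself is counted D times.
    member+codeg : ∀ j x → member grp j x + codeg (u j) x ≡ 1 + only (u j) D x
    member+codeg j x with x ≟ᶠ u j | grp x ≟ᶠ j
    ... | yes refl | yes _    = cong suc (trans (codeg-self (u j)) (deg≡D (u j)))
    ... | yes refl | no  g≢j  = ⊥-elim (g≢j (grp-u j))
    ... | no  x≢uj | yes gx≡j with grp≡⇒∥ (trans gx≡j (sym (grp-u j)))
    ...   | inj₁ x≡uj = ⊥-elim (x≢uj x≡uj)
    ...   | inj₂ x≁uj = cong suc (trans (codeg-sym (u j) x) x≁uj)
    member+codeg j x | no x≢uj | no gx≢j =
      ≤-antisym (codeg≤1 (x≢uj ∘ sym))
                (n≢0⇒n>0 λ uj≁x → gx≢j (trans (sym (∥⇒grp≡ (inj₂ uj≁x))) (grp-u j)))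

    -- Summing member+codeg over x: ∣group j∣ + n = n + D.
    groupSize≡D : ∀ j → groupSize grp j ≡ D
    groupSize≡D j = trans (groupSize≡∑member grp j) (+-cancelʳ-≡ n _ D (begin
        sum (member grp j) + n                        ≡⟨ cong (sum (member grp j) +_) ∑codeg≡n ⟨
        sum (member grp j) + sum (codeg (u j))        ≡⟨ ∑-distrib-+ (member grp j) (codeg (u j)) ⟨
        ∑[ x < n ] (member grp j x + codeg (u j) x)   ≡⟨ sum-cong-≗ (member+codeg j) ⟩
        ∑[ x < n ] (1 + only (u j) D x)               ≡⟨ ∑-distrib-+ (λ _ → 1) (only (u j) D) ⟩
        ∑[ x < n ] 1 + sum (only (u j) D)             ≡⟨ cong₂ _+_ (sum-ones n) (sum-only (u j) D) ⟩
        n + D                                         ≡⟨ +-comm n D ⟩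
        D + n                                         ∎))
      where
      open ≡-Reasoning
      ∑codeg≡n : sum (codeg (u j)) ≡ n
      ∑codeg≡n = trans (∑codeg (u j)) (trans (cong (_* k) (deg≡D (u j))) D*k≡n)

    -- Every edge meets every group: in u j itself, or in the non-neighbour of u j.
    edge-meets-group : ∀ i j → ∃ λ x → x ∈ E i × grp x ≡ j
    edge-meets-group i j with u j ∈? E i
    ... | yes uj∈i = u j , uj∈i , grp-u j
    ... | no  uj∉i with non-neighbour i (u j) uj∉i
    ...   | x , x∈i , x≁uj = x , x∈i , trans (∥⇒grp≡ (inj₂ x≁uj)) (grp-u j)

    edge-transversal : ∀ i {x y} → x ∈ E i → y ∈ E i → grp x ≡ grp y → x ≡ y
    edge-transversal i {x} {y} x∈i y∈i gx≡gy with x ≟ᶠ y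
    ... | yes x≡y = x≡y
    ... | no  x≢y = ⊥-elim (joined⇒∦ i x∈i y∈i x≢y (grp≡⇒∥ gx≡gy))

    transversal : IsTransversalDesign k H
    transversal = grp , size , parts , cross
      where
      size : ∀ j → groupSize grp j * k ≡ n
      size j = trans (cong (_* k) (groupSize≡D j)) D*k≡n
      parts : ∀ e → e ∈E H → ∀ j → Σ (Fin n) λ x → x ∈ e × grp x ≡ j ×
                                                 (∀ y → y ∈ e → grp y ≡ j → y ≡ x)
      parts e e∈H j with edge-index e∈H
      ... | i , refl with edge-meets-group i j
      ...   | x , x∈i , gx≡j =
        x , x∈i , gx≡j , λ y y∈i gy≡j → edge-transversal i y∈i x∈i (trans gy≡j (sym gx≡j))
      cross : ∀ x y → grp x ≢ grp y → Σ (Subset n) λ e → e ∈E H × x ∈ e × y ∈ e ×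
                (∀ e′ → e′ ∈E H → x ∈ e′ → y ∈ e′ → e′ ≡ e)
      cross x y gx≢gy with codeg-pos⇒edge (n≢0⇒n>0 (gx≢gy ∘ ∥⇒grp≡ ∘ inj₂))
      ... | i , x∈i , y∈i = E i , E∈H i , x∈i , y∈i ,
                            λ e′ e′∈H x∈e′ y∈e′ → coincide e′∈H (E∈H i) x≢y x∈e′ y∈e′ x∈i y∈i
        where
        x≢y : x ≢ y
        x≢y x≡y = gx≢gy (cong grp x≡y)

  -- Conversely, in a transversal design every vertex has degree n / k, whence m k² = n².
  module Converse (design : IsTransversalDesign k H) {{k′≢0 : NonZero k′}} where

    grp : Fin n → Fin k
    grp = proj₁ design

    group-size : ∀ j → groupSize grp j * k ≡ n
    group-size = proj₁ (proj₂ design)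

    one-per-group : ∀ e → e ∈E H → ∀ j → Σ (Fin n) λ x → x ∈ e × grp x ≡ j ×
                                                        (∀ y → y ∈ e → grp y ≡ j → y ≡ x)
    one-per-group = proj₁ (proj₂ (proj₂ design))

    cross-edge : ∀ x y → grp x ≢ grp y → Σ (Subset n) λ e → e ∈E H × x ∈ e × y ∈ e ×
                   (∀ e′ → e′ ∈E H → x ∈ e′ → y ∈ e′ → e′ ≡ e)
    cross-edge = proj₂ (proj₂ (proj₂ design))

    others : Fin k → Fin n → ℕ
    others j y = if ⌊ grp y ≟ᶠ j ⌋ then 0 else 1

    member+others : ∀ j y → member grp j y + others j y ≡ 1
    member+others j y with grp y ≟ᶠ j
    ... | yes _ = refl
    ... | no  _ = refl

    others*codeg : ∀ x y → others (grp x) y * codeg x y ≡ others (grp x) y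
    others*codeg x y with grp y ≟ᶠ grp x
    ... | yes _     = refl
    ... | no  gy≢gx with cross-edge x y (gy≢gx ∘ sym)
    ...   | e , e∈H , x∈e , y∈e , _ with edge-index e∈H
    ...     | i , refl = trans (*-identityˡ _) (≤-antisym (codeg≤1 x≢y) (edge⇒codeg-pos i x∈e y∈e))
      where
      x≢y : x ≢ y
      x≢y refl = gy≢gx refl

    outside-group : ∀ i x → x ∈ E i → ∑[ y < n ] (I i y * others (grp x) y) ≡ k′
    outside-group i x x∈i = +-cancelˡ-≡ 1 _ _ (begin
        1 + ∑[ y < n ] (I i y * others (grp x) y)
      ≡⟨ cong (_+ ∑[ y < n ] (I i y * others (grp x) y))
              (trans (sum-single (λ y → I i y * member grp (grp x) y) x elsewhere) at-x) ⟨
        ∑[ y < n ] (I i y * member grp (grp x) y) + ∑[ y < n ] (I i y * others (grp x) y)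
      ≡⟨ ∑-distrib-+ (λ y → I i y * member grp (grp x) y) (λ y → I i y * others (grp x) y) ⟨
        ∑[ y < n ] (I i y * member grp (grp x) y + I i y * others (grp x) y)
      ≡⟨ sum-cong-≗ (λ y → trans (sym (*-distribˡ-+ (I i y) _ _))
                                 (trans (cong (I i y *_) (member+others (grp x) y)) (*-identityʳ _))) ⟩
        sum (I i)
      ≡⟨ ∑I≡k i ⟩
        k
      ∎)
      where
      open ≡-Reasoning
      at-x : I i x * member grp (grp x) x ≡ 1
      at-x with grp x ≟ᶠ grp x
      ... | yes _     = trans (*-identityʳ _) (∈⇒χ≡1 x∈i)
      ... | no  gx≢gx = ⊥-elim (gx≢gx refl)
      elsewhere : ∀ y → y ≢ x → I i y * member grp (grp x) y ≡ 0
      elsewhere y y≢x with y ∈? E i | grp y ≟ᶠ grp x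
      ... | no  y∉i | _        rewrite ∉⇒χ≡0 y∉i = refl
      ... | yes _   | no  _    = *-zeroʳ (I i y)
      ... | yes y∈i | yes gy≡gx with one-per-group (E i) (E∈H i) (grp x)
      ...   | _ , _ , _ , unique =
        ⊥-elim (y≢x (trans (unique y y∈i gy≡gx) (sym (unique x x∈i refl))))

    -- Counting pairs (edge through x, vertex of it outside the group of x).
    cross-count : ∀ x → sum (others (grp x)) ≡ deg x * k′
    cross-count x = begin
        ∑[ y < n ] others (grp x) y
      ≡⟨ sum-cong-≗ (others*codeg x) ⟨
        ∑[ y < n ] (others (grp x) y * codeg x y)
      ≡⟨ sum-cong-≗ (λ y → *-distribˡ-sum (others (grp x) y) (λ i → I i x * I i y)) ⟩
        ∑[ y < n ] ∑[ i < m ] (others (grp x) y * (I i x * I i y))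
      ≡⟨ ∑-comm (λ y i → others (grp x) y * (I i x * I i y)) ⟩
        ∑[ i < m ] ∑[ y < n ] (others (grp x) y * (I i x * I i y))
      ≡⟨ sum-cong-≗ (λ i → trans (sum-cong-≗ λ y → rearrange (others (grp x) y) (I i x) (I i y))
                                 (sym (*-distribˡ-sum (I i x) (λ y → I i y * others (grp x) y)))) ⟩
        ∑[ i < m ] (I i x * ∑[ y < n ] (I i y * others (grp x) y))
      ≡⟨ sum-cong-≗ through-x ⟩
        ∑[ i < m ] (I i x * k′)
      ≡⟨ *-distribʳ-sum k′ (λ i → I i x) ⟨
        deg x * k′
      ∎
      where
      open ≡-Reasoning
      rearrange : ∀ a b c → a * (b * c) ≡ b * (c * a)
      rearrange = solve-∀
      through-x : ∀ i → I i x * ∑[ y < n ] (I i y * others (grp x) y) ≡ I i x * k′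
      through-x i with x ∈? E i
      ... | yes x∈i = cong (I i x *_) (outside-group i x x∈i)
      ... | no  x∉i rewrite ∉⇒χ≡0 x∉i = refl

    group-count : ∀ x → sum (others (grp x)) * k + n ≡ n * k
    group-count x = begin
        sum (others (grp x)) * k + n
      ≡⟨ cong (sum (others (grp x)) * k +_) (trans (cong (_* k) (sym (groupSize≡∑member grp (grp x))))
                                                  (group-size (grp x))) ⟨
        sum (others (grp x)) * k + sum (member grp (grp x)) * k
      ≡⟨ *-distribʳ-+ k (sum (others (grp x))) (sum (member grp (grp x))) ⟨
        (sum (others (grp x)) + sum (member grp (grp x))) * k
      ≡⟨ cong (_* k) (∑-distrib-+ (others (grp x)) (member grp (grp x))) ⟨
        (∑[ y < n ] (others (grp x) y + member grp (grp x) y)) * k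
      ≡⟨ cong (_* k) (sum-cong-≗ λ y → trans (+-comm (others (grp x) y) (member grp (grp x) y))
                                             (member+others (grp x) y)) ⟩
        (∑[ y < n ] 1) * k
      ≡⟨ cong (_* k) (sum-ones n) ⟩
        n * k
      ∎
      where open ≡-Reasoning

    deg*k≡n : ∀ x → deg x * k ≡ n
    deg*k≡n x = *-cancelʳ-≡ (deg x * k) n k′ (+-cancelʳ-≡ n _ _ (begin
        deg x * k * k′ + n             ≡⟨ cong (_+ n) (swap (deg x) k k′) ⟩
        deg x * k′ * k + n             ≡⟨ cong (λ z → z * k + n) (cross-count x) ⟨
        sum (others (grp x)) * k + n   ≡⟨ group-count x ⟩
        n * k                          ≡⟨ *-suc n k′ ⟩
        n + n * k′                     ≡⟨ +-comm n (n * k′) ⟩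
        n * k′ + n                     ∎))
      where
      open ≡-Reasoning
      swap : ∀ a b c → a * b * c ≡ a * c * b
      swap = solve-∀

    edge-count : m * k * k ≡ n * n
    edge-count = begin
        m * k * k                ≡⟨ cong (_* k) ∑deg≡mk ⟨
        sum deg * k              ≡⟨ *-distribʳ-sum k deg ⟩
        ∑[ x < n ] (deg x * k)   ≡⟨ sum-cong-≗ deg*k≡n ⟩
        ∑[ x < n ] n             ≡⟨ sum-const n n ⟩
        n * n                    ∎
      where open ≡-Reasoning

  module FanFree (no-fan : ¬ ContainsFan k H) {{k′≢0 : NonZero k′}} where

    regroup : ∀ a b → a * (b * a) ≡ b * (a * a)
    regroup = solve-∀

    reach≤k′ : ∀ g v → v ∉ E g → reach g v ≤ k′
    reach≤k′ g v v∉g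
      with m≤n⇒m<n∨m≡n (subst (reach g v ≤_) (∑I≡k g) (sum-mono (reach-term≤ g v v∉g)))
    ... | inj₁ (s≤s reach≤k′) = reach≤k′
    ... | inj₂ reach≡k        = ⊥-elim (no-fan (reach≡k⇒fan g v v∉g reach≡k))

    O*reach≤ : ∀ g v → O g v * reach g v ≤ O g v * k′
    O*reach≤ g v with v ∈? E g
    ... | yes v∈g rewrite ∈⇒χᶜ≡0 v∈g = z≤n
    ... | no  v∉g rewrite ∉⇒χᶜ≡1 v∉g = *-monoʳ-≤ 1 (reach≤k′ g v v∉g)

    degSum≤n : ∀ g → degSum g ≤ n
    degSum≤n g = *-cancelˡ-≤ k′ (begin
        k′ * degSum g                             ≡⟨ degSum-identity g ⟩
        k′ * k + ∑[ v < n ] (O g v * reach g v)   ≤⟨ +-monoʳ-≤ (k′ * k) (sum-mono (O*reach≤ g)) ⟩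
        k′ * k + ∑[ v < n ] (O g v * k′)          ≡⟨ sym (k′*n-identity g) ⟩
        k′ * n                                    ∎)
      where open ≤-Reasoning

    ∑degSum≤mn : sum degSum ≤ m * n
    ∑degSum≤mn = subst (sum degSum ≤_) (sum-const m n) (sum-mono degSum≤n)

    cs-lower : m * (m * k * k) ≤ n * ∑[ x < n ] (deg x * deg x)
    cs-lower = subst (_≤ n * ∑[ x < n ] (deg x * deg x)) ∑deg²-as-edges (cauchy-schwarz deg)

    cs-upper : n * ∑[ x < n ] (deg x * deg x) ≤ m * (n * n)
    cs-upper = begin
        n * ∑[ x < n ] (deg x * deg x)   ≡⟨ cong (n *_) ∑deg²≡∑degSum ⟩
        n * sum degSum                   ≤⟨ *-monoʳ-≤ n ∑degSum≤mn ⟩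
        n * (m * n)                      ≡⟨ regroup n m ⟩
        m * (n * n)                      ∎
      where open ≤-Reasoning

    edge-bound : m * k * k ≤ n * n
    edge-bound with m ≟ 0
    ... | yes m≡0 = subst (λ z → z * k * k ≤ n * n) (sym m≡0) z≤n
    ... | no  m≢0 = *-cancelˡ-≤ m {{≢-nonZero m≢0}} (≤-trans cs-lower cs-upper)

    -- Equality  m k² = n²  squeezes every inequality used above.
    module Extremal (x₀ : Fin n) (extremal : m * k * k ≡ n * n) where

      instance
        n≢0 : NonZero n
        n≢0 = nonZeroIndex x₀

      cs-tight : n * ∑[ x < n ] (deg x * deg x) ≡ sum deg * sum deg
      cs-tight = ≤-antisym (subst (n * ∑[ x < n ] (deg x * deg x) ≤_) (sym square-as-mn²) cs-upper)
                           (cauchy-schwarz deg)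
        where
        square-as-mn² : sum deg * sum deg ≡ m * (n * n)
        square-as-mn² = trans ∑deg²-as-edges (cong (m *_) extremal)

      deg-constant : ∀ x y → deg x ≡ deg y
      deg-constant = cauchy-schwarz-≡ deg cs-tight

      degSum≡n : ∀ g → degSum g ≡ n
      degSum≡n = sum-mono-≡ degSum≤n (trans ∑degSum≡mn (sym (sum-const m n)))
        where
        ∑degSum≡mn : sum degSum ≡ m * n
        ∑degSum≡mn = ≤-antisym ∑degSum≤mn (*-cancelˡ-≤ n (begin
            n * (m * n)                      ≡⟨ regroup n m ⟩
            m * (n * n)                      ≡⟨ cong (m *_) extremal ⟨
            m * (m * k * k)                  ≤⟨ cs-lower ⟩
            n * ∑[ x < n ] (deg x * deg x)   ≡⟨ cong (n *_) ∑deg²≡∑degSum ⟩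
            n * sum degSum                   ∎))
          where open ≤-Reasoning

      reach≡k′ : ∀ g v → v ∉ E g → reach g v ≡ k′
      reach≡k′ g v v∉g = begin
          reach g v            ≡⟨ *-identityˡ (reach g v) ⟨
          1 * reach g v        ≡⟨ cong (_* reach g v) (∉⇒χᶜ≡1 v∉g) ⟨
          O g v * reach g v    ≡⟨ sum-mono-≡ (O*reach≤ g) sums-agree v ⟩
          O g v * k′           ≡⟨ cong (_* k′) (∉⇒χᶜ≡1 v∉g) ⟩
          1 * k′               ≡⟨ *-identityˡ k′ ⟩
          k′                   ∎
        where
        open ≡-Reasoning
        sums-agree : ∑[ v < n ] (O g v * reach g v) ≡ ∑[ v < n ] (O g v * k′)
        sums-agree = +-cancelˡ-≡ (k′ * k) _ (∑[ v < n ] (O g v * k′))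
          (trans (sym (degSum-identity g)) (trans (cong (k′ *_) (degSum≡n g)) (k′*n-identity g)))

      D : ℕ
      D = deg x₀

      D*k≡n : D * k ≡ n
      D*k≡n = *-cancelˡ-≡ (D * k) n n (begin
          n * (D * k)          ≡⟨ *-assoc n D k ⟨
          n * D * k            ≡⟨ cong (_* k) (sum-const n D) ⟨
          (∑[ x < n ] D) * k   ≡⟨ cong (_* k) (sum-cong-≗ λ x → deg-constant x x₀) ⟨
          sum deg * k          ≡⟨ cong (_* k) ∑deg≡mk ⟩
          m * k * k            ≡⟨ extremal ⟩
          n * n                ∎)
        where open ≡-Reasoning

      0<m : 0 < m
      0<m = n≢0⇒n>0 λ m≡0 → ≢-nonZero⁻¹ (n * n) {{m*n≢0 n n}}
              (trans (sym extremal) (cong (λ z → z * k * k) m≡0))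

    extremal⇔design : Fin n → (m * k * k ≡ n * n ⇔ (k ∣ n × IsTransversalDesign k H))
    extremal⇔design x₀ = mk⇔ extremal⇒design (λ (_ , design) → Converse.edge-count design)
      where
      extremal⇒design : m * k * k ≡ n * n → k ∣ n × IsTransversalDesign k H
      extremal⇒design extremal =
        divides D (sym D*k≡n) ,
        Design.transversal reach≡k′ D (λ x → deg-constant x x₀) D*k≡n (fromℕ< 0<m)
        where open Extremal x₀ extremal

theorem1p1 : (k n : ℕ) → 2 ≤ k → 1 ≤ n → (H : Hypergraph n) →
    IsUniform k H → IsLinear H → ¬ ContainsFan k H →
    (numEdges H * (k * k) ≤ n * n) ×
    (numEdges H * (k * k) ≡ n * n ⇔ (k ∣ n × IsTransversalDesign k H))
theorem1p1 (suc (suc k″)) n (s≤s (s≤s z≤n)) 1≤n H (distinct , uniform) linear no-fan =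
  subst (_≤ n * n) (*-assoc m k k) edge-bound ,
  subst (λ e → e ≡ n * n ⇔ (k ∣ n × IsTransversalDesign k H)) (*-assoc m k k)
        (extremal⇔design (fromℕ< 1≤n))
  where
  open Counting H distinct uniform linear
  open FanFree no-fan
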